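{- Let $v\ge 2$ and let $M=M_2(v,3)$ be the $2$-inclusion matrix defined in the context, over the reals. There exists a basis of the null space $\{\mathbf T\in\mathbb R^{V^3}: M\mathbf T=\mathbf 0\}$ consisting only of (frequency vectors of) intercalates.
   Context: Let $V=\{0,1,\ldots,v-1\}$. For a $2$-subset $I=\{i_1<i_2\}$ of $\{1,2,3\}$ and $u_1,u_2\in V$, say $(u_1,u_2)_I\in(x_1,x_2,x_3)$ iff $u_1=x_{i_1}$ and $u_2=x_{i_2}$. The matrix $M_2(v,3)$ has columns indexed by $V^3$, rows indexed by all pairs $(u_1,u_2)_I$ with $I$ ranging over the $2$-subsets of $\{1,2,3\}$ and $u_1,u_2\in V$, and entry $1$ in row $(u_1,u_2)_I$, column $\mathbf x$ iff $(u_1,u_2)_I\in\mathbf x$, else $0$. A triple $(i,j,k)\in V^3$ is read as "symbol $k$ in cell $(i,j)$" of a $v\times v$ array. An intercalate is a Latin trade of volume $4$: given rows $r_1\neq r_2$, columns $c_1\ne c_2$ and symbols $a\neq b$ in $V$, its frequency vector $\mathbf T\in\mathbb R^{V^3}$ has $\mathbf T=+1$ at $(r_1,c_1,a),(r_2,c_2,a),(r_1,c_2,b),(r_2,c_1,b)$, $\mathbf T=-1$ at $(r_1,c_1,b),(r_2,c_2,b),(r_1,c_2,a),(r_2,c_1,a)$, and $0$ elsewhere (up to an overall sign, i.e., interchanging the two partial Latin squares).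
   Formalization: The coefficient field is ℚ instead of ℝ: the null space consists of rational vectors on V³, and linear independence and spanning use rational coefficients. -}

module Defs where

open import Data.Nat using (ℕ; zero; suc)
open import Data.Fin using (Fin; zero; suc; _≟_)
open import Data.Product using (_×_; _,_; Σ; ∃; ∃-syntax)
open import Data.Bool using (Bool; true; false; if_then_else_; _∧_; _∨_)
open import Data.Rational using (ℚ; 0ℚ; 1ℚ; _+_; _*_; -_)
open import Relation.Nullary.Decidable using (⌊_⌋)
open import Relation.Binary.PropositionalEquality using (_≡_; _≢_)

-- The symbol set V = {0,…,v-1}; points of V³ are triples (row, column, symbol).
V : ℕ → Set
V v = Fin v

Point : ℕ → Set
Point v = V v × V v × V v

Σᶠ : (n : ℕ) → (Fin n → ℚ) → ℚ
Σᶠ zero    f = 0ℚ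
Σᶠ (suc n) f = f zero + Σᶠ n (λ i → f (suc i))

Σᵖ : (v : ℕ) → (Point v → ℚ) → ℚ
Σᵖ v f = Σᶠ v (λ i → Σᶠ v (λ j → Σᶠ v (λ k → f (i , j , k))))

data TwoSubset : Set where
  I12 I13 I23 : TwoSubset

Row : ℕ → Set
Row v = TwoSubset × V v × V v

_∈ᵇ_ : ∀ {v} → Row v → Point v → Bool
(I12 , u₁ , u₂) ∈ᵇ (x₁ , x₂ , x₃) = ⌊ u₁ ≟ x₁ ⌋ ∧ ⌊ u₂ ≟ x₂ ⌋
(I13 , u₁ , u₂) ∈ᵇ (x₁ , x₂ , x₃) = ⌊ u₁ ≟ x₁ ⌋ ∧ ⌊ u₂ ≟ x₃ ⌋
(I23 , u₁ , u₂) ∈ᵇ (x₁ , x₂ , x₃) = ⌊ u₁ ≟ x₂ ⌋ ∧ ⌊ u₂ ≟ x₃ ⌋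

M₂ : (v : ℕ) → Row v → Point v → ℚ
M₂ v r x = if r ∈ᵇ x then 1ℚ else 0ℚ

Vect : ℕ → Set
Vect v = Point v → ℚ

_·M_ : ∀ {v} → (Row v → Point v → ℚ) → Vect v → Row v → ℚ
_·M_ {v} M T r = Σᵖ v (λ x → M r x * T x)

InNullSpace : (v : ℕ) → Vect v → Set
InNullSpace v T = ∀ (r : Row v) → (M₂ v ·M T) r ≡ 0ℚ

_==ᵖ_ : ∀ {v} → Point v → Point v → Bool
(a , b , c) ==ᵖ (a' , b' , c') = ⌊ a ≟ a' ⌋ ∧ ⌊ b ≟ b' ⌋ ∧ ⌊ c ≟ c' ⌋

record Intercalate (v : ℕ) : Set where
  field
    r₁ r₂ c₁ c₂ a b : V v
    r₁≢r₂ : r₁ ≢ r₂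
    c₁≢c₂ : c₁ ≢ c₂
    a≢b   : a ≢ b

freq : ∀ {v} → Intercalate v → Vect v
freq ι x =
  if (x ==ᵖ (r₁ , c₁ , a)) ∨ (x ==ᵖ (r₂ , c₂ , a)) ∨ (x ==ᵖ (r₁ , c₂ , b)) ∨ (x ==ᵖ (r₂ , c₁ , b))
  then 1ℚ
  else (if (x ==ᵖ (r₁ , c₁ , b)) ∨ (x ==ᵖ (r₂ , c₂ , b)) ∨ (x ==ᵖ (r₁ , c₂ , a)) ∨ (x ==ᵖ (r₂ , c₁ , a))
        then - 1ℚ
        else 0ℚ)
  where open Intercalate ι

lincomb : ∀ {v m} → (Fin m → ℚ) → (Fin m → Vect v) → Vect v
lincomb {m = m} c B x = Σᶠ m (λ i → c i * B i x)

IsNullSpaceBasis : (v m : ℕ) → (Fin m → Vect v) → Set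
IsNullSpaceBasis v m B =
    (∀ i → InNullSpace v (B i))
  × (∀ (c : Fin m → ℚ) → (∀ x → lincomb c B x ≡ 0ℚ) → ∀ i → c i ≡ 0ℚ)
  × (∀ (T : Vect v) → InNullSpace v T → ∃[ c ] (∀ x → T x ≡ lincomb c B x))

-- The frequency vector of an intercalate is the tensor product
-- (e_{r₁} − e_{r₂}) ⊗ (e_{c₁} − e_{c₂}) ⊗ (e_a − e_b), and row (u₁,u₂)_I of M₂(v,3) sums a
-- vector along a line of V³; every factor sums to zero, so intercalates lie in the null space.
-- Writing v = w + 1, the w³ intercalates on rows {0, i+1}, columns {0, j+1} and symbols
-- {0, k+1} restrict to the identity matrix on the inner points (i+1, j+1, k+1), which gives
-- independence. A null vector is determined by its values on the inner points, because the
-- zero line sums recover every point with a zero coordinate; hence every null vector T equals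
-- Σ_t T(inner t) · freq(ι_t), and the family spans.

module Submission where

open import Defs
open import Data.Nat using (ℕ; _≤_; zero; suc; _*_)
open import Data.Fin using (Fin; zero; suc)
open import Data.Fin.Properties using (_≟_; suc-injective; *↔×)
open import Data.Product using (Σ; ∃-syntax; _,_)
open import Data.Product.Function.NonDependent.Propositional using (_×-↔_)
open import Data.Bool using (Bool; true; false; if_then_else_; _∧_; _∨_)
open import Data.Rational using (ℚ; 0ℚ; 1ℚ; _+_; -_; _-_) renaming (_*_ to _·_)
open import Data.Rational.Properties
  using (+-*-ring; +-0-group; +-identityʳ; +-identityˡ; neg-distrib-+; +-inverseʳ;
         *-identityˡ; *-identityʳ; *-zeroˡ; *-zeroʳ; *-assoc; *-comm)
open import Algebra.Bundles using (Ring)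
open import Algebra.Properties.Semiring.Sum (Ring.semiring +-*-ring)
  using (sum; ∑-distrib-+; *-distribˡ-sum)
open import Algebra.Properties.Group +-0-group using (∙-cancelʳ)
open import Function using (_∘_; _↔_; Inverse; Injection)
open import Function.Properties.Inverse using (↔-refl; ↔-trans; ↔⇒↣)
open import Data.Empty using (⊥-elim)
open import Relation.Nullary using (Dec; yes; no)
open import Relation.Nullary.Decidable using (⌊_⌋)
open import Relation.Binary.PropositionalEquality
open ≡-Reasoning

Σᶠ-cong : ∀ n {f g : Fin n → ℚ} → (∀ i → f i ≡ g i) → Σᶠ n f ≡ Σᶠ n g
Σᶠ-cong zero    f≗g = refl
Σᶠ-cong (suc n) f≗g = cong₂ _+_ (f≗g zero) (Σᶠ-cong n (f≗g ∘ suc))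

Σᶠ-zero : ∀ n {f : Fin n → ℚ} → (∀ i → f i ≡ 0ℚ) → Σᶠ n f ≡ 0ℚ
Σᶠ-zero zero    f≗0 = refl
Σᶠ-zero (suc n) f≗0 = cong₂ _+_ (f≗0 zero) (Σᶠ-zero n (f≗0 ∘ suc))

Σᶠ-single : ∀ n {f : Fin n → ℚ} (u : Fin n) → (∀ i → i ≢ u → f i ≡ 0ℚ) → Σᶠ n f ≡ f u
Σᶠ-single (suc n) {f} zero    off =
  trans (cong (f zero +_) (Σᶠ-zero n (λ i → off (suc i) (λ ())))) (+-identityʳ (f zero))
Σᶠ-single (suc n) {f} (suc u) off =
  trans (cong₂ _+_ (off zero (λ ())) (Σᶠ-single n u (λ i i≢u → off (suc i) (i≢u ∘ suc-injective))))
        (+-identityˡ (f (suc u)))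

Σᶠ≡sum : ∀ n (f : Fin n → ℚ) → Σᶠ n f ≡ sum f
Σᶠ≡sum zero    f = refl
Σᶠ≡sum (suc n) f = cong (f zero +_) (Σᶠ≡sum n (f ∘ suc))

Σᶠ-distrib-+ : ∀ n (f g : Fin n → ℚ) → Σᶠ n (λ i → f i + g i) ≡ Σᶠ n f + Σᶠ n g
Σᶠ-distrib-+ n f g = begin
  Σᶠ n (λ i → f i + g i) ≡⟨ Σᶠ≡sum n _ ⟩
  sum (λ i → f i + g i)  ≡⟨ ∑-distrib-+ f g ⟩
  sum f + sum g          ≡⟨ sym (cong₂ _+_ (Σᶠ≡sum n f) (Σᶠ≡sum n g)) ⟩
  Σᶠ n f + Σᶠ n g        ∎

Σᶠ-neg : ∀ n (f : Fin n → ℚ) → Σᶠ n (λ i → - f i) ≡ - Σᶠ n f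
Σᶠ-neg zero    f = refl
Σᶠ-neg (suc n) f =
  trans (cong (- f zero +_) (Σᶠ-neg n (f ∘ suc))) (sym (neg-distrib-+ (f zero) (Σᶠ n (f ∘ suc))))

Σᶠ-scaleˡ : ∀ n (c : ℚ) (f : Fin n → ℚ) → Σᶠ n (λ i → c · f i) ≡ c · Σᶠ n f
Σᶠ-scaleˡ n c f = begin
  Σᶠ n (λ i → c · f i) ≡⟨ Σᶠ≡sum n _ ⟩
  sum (λ i → c · f i)  ≡⟨ sym (*-distribˡ-sum c f) ⟩
  c · sum f            ≡⟨ sym (cong (c ·_) (Σᶠ≡sum n f)) ⟩
  c · Σᶠ n f           ∎

Σᶠ-comm : ∀ n m (f : Fin n → Fin m → ℚ) →
  Σᶠ n (λ i → Σᶠ m (f i)) ≡ Σᶠ m (λ j → Σᶠ n (λ i → f i j))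
Σᶠ-comm zero    m f = sym (Σᶠ-zero m (λ _ → refl))
Σᶠ-comm (suc n) m f =
  trans (cong (Σᶠ m (f zero) +_) (Σᶠ-comm n m (f ∘ suc))) (sym (Σᶠ-distrib-+ m _ _))

Σᶠ-cancel-head : ∀ n {f g : Fin (suc n) → ℚ} →
  Σᶠ (suc n) f ≡ Σᶠ (suc n) g → (∀ i → f (suc i) ≡ g (suc i)) → f zero ≡ g zero
Σᶠ-cancel-head n {f} {g} Σf≡Σg tails =
  ∙-cancelʳ (Σᶠ n (f ∘ suc)) (f zero) (g zero)
    (trans Σf≡Σg (cong (g zero +_) (sym (Σᶠ-cong n tails))))

Σᵖ-cong : ∀ v {f g : Point v → ℚ} → (∀ x → f x ≡ g x) → Σᵖ v f ≡ Σᵖ v g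
Σᵖ-cong v f≗g = Σᶠ-cong v (λ i → Σᶠ-cong v (λ j → Σᶠ-cong v (λ k → f≗g (i , j , k))))

ind : Bool → ℚ
ind b = if b then 1ℚ else 0ℚ

ind-∧-· : ∀ a b t → ind (a ∧ b) · t ≡ ind a · (ind b · t)
ind-∧-· true  b t = sym (*-identityˡ (ind b · t))
ind-∧-· false b t = trans (*-zeroˡ t) (sym (*-zeroˡ (ind b · t)))

δ : ∀ {n} → Fin n → Fin n → ℚ
δ x y = ind ⌊ x ≟ y ⌋

δ-refl : ∀ {n} (x : Fin n) → δ x x ≡ 1ℚ
δ-refl x with x ≟ x
... | yes _  = refl
... | no x≢x = ⊥-elim (x≢x refl)

δ-≢ : ∀ {n} {x y : Fin n} → x ≢ y → δ x y ≡ 0ℚ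
δ-≢ {x = x} {y} x≢y with x ≟ y
... | yes x≡y = ⊥-elim (x≢y x≡y)
... | no _    = refl

δ-suc : ∀ {n} (x y : Fin n) → δ (suc x) (suc y) ≡ δ x y
δ-suc x y with x ≟ y
... | yes _ = refl
... | no _  = refl

Σᶠ-δ : ∀ n (a : Fin n) → Σᶠ n (λ x → δ x a) ≡ 1ℚ
Σᶠ-δ n a = trans (Σᶠ-single n a (λ _ → δ-≢)) (δ-refl a)

Σᶠ-sift : ∀ n (u : Fin n) (f : Fin n → ℚ) → Σᶠ n (λ x → δ u x · f x) ≡ f u
Σᶠ-sift n u f = trans (Σᶠ-single n u off) (trans (cong (_· f u) (δ-refl u)) (*-identityˡ (f u)))
  where
  off : ∀ x → x ≢ u → δ u x · f x ≡ 0ℚ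
  off x x≢u = trans (cong (_· f x) (δ-≢ (x≢u ∘ sym))) (*-zeroˡ (f x))

line : ∀ {v} → Row v → V v → Point v
line (I12 , u₁ , u₂) t = (u₁ , u₂ , t)
line (I13 , u₁ , u₂) t = (u₁ , t , u₂)
line (I23 , u₁ , u₂) t = (t , u₁ , u₂)

lineSum : ∀ {v} → Row v → Vect v → ℚ
lineSum {v} r T = Σᶠ v (λ t → T (line r t))

M₂-·M-lineSum : ∀ v (T : Vect v) r → (M₂ v ·M T) r ≡ lineSum r T
M₂-·M-lineSum v T (I12 , u₁ , u₂) = begin
  Σᵖ v (λ x → M₂ v (I12 , u₁ , u₂) x · T x)
    ≡⟨ Σᵖ-cong v (λ (i , j , k) → ind-∧-· ⌊ u₁ ≟ i ⌋ ⌊ u₂ ≟ j ⌋ (T (i , j , k))) ⟩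
  Σᶠ v (λ i → Σᶠ v (λ j → Σᶠ v (λ k → δ u₁ i · (δ u₂ j · T (i , j , k)))))
    ≡⟨ Σᶠ-cong v (λ i → Σᶠ-cong v (λ j → trans (Σᶠ-scaleˡ v (δ u₁ i) _)
                                               (cong (δ u₁ i ·_) (Σᶠ-scaleˡ v (δ u₂ j) _)))) ⟩
  Σᶠ v (λ i → Σᶠ v (λ j → δ u₁ i · (δ u₂ j · Σᶠ v (λ k → T (i , j , k)))))
    ≡⟨ Σᶠ-cong v (λ i → Σᶠ-scaleˡ v (δ u₁ i) _) ⟩
  Σᶠ v (λ i → δ u₁ i · Σᶠ v (λ j → δ u₂ j · Σᶠ v (λ k → T (i , j , k))))
    ≡⟨ Σᶠ-sift v u₁ _ ⟩
  Σᶠ v (λ j → δ u₂ j · Σᶠ v (λ k → T (u₁ , j , k)))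
    ≡⟨ Σᶠ-sift v u₂ _ ⟩
  Σᶠ v (λ k → T (u₁ , u₂ , k)) ∎
M₂-·M-lineSum v T (I13 , u₁ , u₂) = begin
  Σᵖ v (λ x → M₂ v (I13 , u₁ , u₂) x · T x)
    ≡⟨ Σᵖ-cong v (λ (i , j , k) → ind-∧-· ⌊ u₁ ≟ i ⌋ ⌊ u₂ ≟ k ⌋ (T (i , j , k))) ⟩
  Σᶠ v (λ i → Σᶠ v (λ j → Σᶠ v (λ k → δ u₁ i · (δ u₂ k · T (i , j , k)))))
    ≡⟨ Σᶠ-cong v (λ i → trans (Σᶠ-cong v (λ j → Σᶠ-scaleˡ v (δ u₁ i) _)) (Σᶠ-scaleˡ v (δ u₁ i) _)) ⟩
  Σᶠ v (λ i → δ u₁ i · Σᶠ v (λ j → Σᶠ v (λ k → δ u₂ k · T (i , j , k))))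
    ≡⟨ Σᶠ-sift v u₁ _ ⟩
  Σᶠ v (λ j → Σᶠ v (λ k → δ u₂ k · T (u₁ , j , k)))
    ≡⟨ Σᶠ-cong v (λ j → Σᶠ-sift v u₂ _) ⟩
  Σᶠ v (λ j → T (u₁ , j , u₂)) ∎
M₂-·M-lineSum v T (I23 , u₁ , u₂) = begin
  Σᵖ v (λ x → M₂ v (I23 , u₁ , u₂) x · T x)
    ≡⟨ Σᵖ-cong v (λ (i , j , k) → ind-∧-· ⌊ u₁ ≟ j ⌋ ⌊ u₂ ≟ k ⌋ (T (i , j , k))) ⟩
  Σᶠ v (λ i → Σᶠ v (λ j → Σᶠ v (λ k → δ u₁ j · (δ u₂ k · T (i , j , k)))))
    ≡⟨ Σᶠ-cong v (λ i → Σᶠ-cong v (λ j → Σᶠ-scaleˡ v (δ u₁ j) _)) ⟩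
  Σᶠ v (λ i → Σᶠ v (λ j → δ u₁ j · Σᶠ v (λ k → δ u₂ k · T (i , j , k))))
    ≡⟨ Σᶠ-cong v (λ i → Σᶠ-sift v u₁ _) ⟩
  Σᶠ v (λ i → Σᶠ v (λ k → δ u₂ k · T (i , u₁ , k)))
    ≡⟨ Σᶠ-cong v (λ i → Σᶠ-sift v u₂ _) ⟩
  Σᶠ v (λ i → T (i , u₁ , u₂)) ∎

lineSum-null : ∀ {v} {T : Vect v} → InNullSpace v T → ∀ r → lineSum r T ≡ 0ℚ
lineSum-null {v} {T} T-null r = trans (sym (M₂-·M-lineSum v T r)) (T-null r)

null-lineSum : ∀ {v} {T : Vect v} → (∀ r → lineSum r T ≡ 0ℚ) → InNullSpace v T
null-lineSum {v} {T} lines r = trans (M₂-·M-lineSum v T r) (lines r)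

lincomb-null : ∀ {v m} (c : Fin m → ℚ) (B : Fin m → Vect v) →
  (∀ l → InNullSpace v (B l)) → InNullSpace v (lincomb c B)
lincomb-null {v} {m} c B B-null = null-lineSum λ r → begin
  Σᶠ v (λ t → Σᶠ m (λ l → c l · B l (line r t))) ≡⟨ Σᶠ-comm v m _ ⟩
  Σᶠ m (λ l → Σᶠ v (λ t → c l · B l (line r t))) ≡⟨ Σᶠ-cong m (λ l → Σᶠ-scaleˡ v (c l) _) ⟩
  Σᶠ m (λ l → c l · lineSum r (B l))             ≡⟨ Σᶠ-zero m (λ l → vanish l r) ⟩
  0ℚ                                             ∎
  where
  vanish : ∀ l r → c l · lineSum r (B l) ≡ 0ℚ
  vanish l r = trans (cong (c l ·_) (lineSum-null (B-null l) r)) (*-zeroʳ (c l))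

tensor : ∀ {v} → (V v → ℚ) → (V v → ℚ) → (V v → ℚ) → Vect v
tensor f g h (x , y , z) = f x · (g y · h z)

Σᶠ-proportional-zero : ∀ n {F f : Fin n → ℚ} (c : ℚ) →
  (∀ t → F t ≡ c · f t) → Σᶠ n f ≡ 0ℚ → Σᶠ n F ≡ 0ℚ
Σᶠ-proportional-zero n {F} {f} c F≗cf Σf≡0 = begin
  Σᶠ n F               ≡⟨ Σᶠ-cong n F≗cf ⟩
  Σᶠ n (λ t → c · f t) ≡⟨ Σᶠ-scaleˡ n c f ⟩
  c · Σᶠ n f           ≡⟨ cong (c ·_) Σf≡0 ⟩
  c · 0ℚ               ≡⟨ *-zeroʳ c ⟩
  0ℚ                   ∎

tensor-lineSum : ∀ {v} {f g h : V v → ℚ} → Σᶠ v f ≡ 0ℚ → Σᶠ v g ≡ 0ℚ → Σᶠ v h ≡ 0ℚ →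
  ∀ r → lineSum r (tensor f g h) ≡ 0ℚ
tensor-lineSum {v} {f} {g} {h} Σf≡0 Σg≡0 Σh≡0 (I12 , u₁ , u₂) =
  Σᶠ-proportional-zero v (f u₁ · g u₂) (λ t → sym (*-assoc (f u₁) (g u₂) (h t))) Σh≡0
tensor-lineSum {v} {f} {g} {h} Σf≡0 Σg≡0 Σh≡0 (I13 , u₁ , u₂) =
  Σᶠ-proportional-zero v (f u₁ · h u₂)
    (λ t → trans (cong (f u₁ ·_) (*-comm (g t) (h u₂))) (sym (*-assoc (f u₁) (h u₂) (g t)))) Σg≡0
tensor-lineSum {v} {f} {g} {h} Σf≡0 Σg≡0 Σh≡0 (I23 , u₁ , u₂) =
  Σᶠ-proportional-zero v (g u₁ · h u₂) (λ t → *-comm (f t) (g u₁ · h u₂)) Σf≡0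

diff : ∀ {n} → Fin n → Fin n → Fin n → ℚ
diff a b x = δ x a - δ x b

Σᶠ-diff : ∀ n (a b : Fin n) → Σᶠ n (diff a b) ≡ 0ℚ
Σᶠ-diff n a b = begin
  Σᶠ n (λ x → δ x a - δ x b)                ≡⟨ Σᶠ-distrib-+ n _ _ ⟩
  Σᶠ n (λ x → δ x a) + Σᶠ n (λ x → - δ x b) ≡⟨ cong (Σᶠ n (λ x → δ x a) +_) (Σᶠ-neg n (λ x → δ x b)) ⟩
  Σᶠ n (λ x → δ x a) - Σᶠ n (λ x → δ x b)   ≡⟨ cong₂ _-_ (Σᶠ-δ n a) (Σᶠ-δ n b) ⟩
  1ℚ - 1ℚ                                   ≡⟨ +-inverseʳ 1ℚ ⟩
  0ℚ                                        ∎

data AtMostOne : Bool → Bool → Set where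
  first   : AtMostOne true  false
  second  : AtMostOne false true
  neither : AtMostOne false false

atMostOne : ∀ {n} {a b : Fin n} → a ≢ b → ∀ x → AtMostOne ⌊ x ≟ a ⌋ ⌊ x ≟ b ⌋
atMostOne {a = a} {b} a≢b x with x ≟ a | x ≟ b
... | yes refl | yes refl = ⊥-elim (a≢b refl)
... | yes _    | no _     = first
... | no _     | yes _    = second
... | no _     | no _     = neither

signPattern : (p₁ p₂ q₁ q₂ s₁ s₂ : Bool) → ℚ
signPattern p₁ p₂ q₁ q₂ s₁ s₂ =
  if (p₁ ∧ q₁ ∧ s₁) ∨ (p₂ ∧ q₂ ∧ s₁) ∨ (p₁ ∧ q₂ ∧ s₂) ∨ (p₂ ∧ q₁ ∧ s₂)
  then 1ℚ
  else (if (p₁ ∧ q₁ ∧ s₂) ∨ (p₂ ∧ q₂ ∧ s₂) ∨ (p₁ ∧ q₂ ∧ s₁) ∨ (p₂ ∧ q₁ ∧ s₁)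
        then - 1ℚ
        else 0ℚ)

sign-product : ∀ {p₁ p₂ q₁ q₂ s₁ s₂} →
  AtMostOne p₁ p₂ → AtMostOne q₁ q₂ → AtMostOne s₁ s₂ →
  signPattern p₁ p₂ q₁ q₂ s₁ s₂ ≡ (ind p₁ - ind p₂) · ((ind q₁ - ind q₂) · (ind s₁ - ind s₂))
sign-product first   first   first   = refl
sign-product first   first   second  = refl
sign-product first   first   neither = refl
sign-product first   second  first   = refl
sign-product first   second  second  = refl
sign-product first   second  neither = refl
sign-product first   neither first   = refl
sign-product first   neither second  = refl
sign-product first   neither neither = refl
sign-product second  first   first   = refl
sign-product second  first   second  = refl
sign-product second  first   neither = refl
sign-product second  second  first   = refl
sign-product second  second  second  = refl
sign-product second  second  neither = refl
sign-product second  neither first   = refl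
sign-product second  neither second  = refl
sign-product second  neither neither = refl
sign-product neither first   first   = refl
sign-product neither first   second  = refl
sign-product neither first   neither = refl
sign-product neither second  first   = refl
sign-product neither second  second  = refl
sign-product neither second  neither = refl
sign-product neither neither first   = refl
sign-product neither neither second  = refl
sign-product neither neither neither = refl

module _ {v : ℕ} (ι : Intercalate v) where
  open Intercalate ι

  freq-tensor : ∀ x → freq ι x ≡ tensor (diff r₁ r₂) (diff c₁ c₂) (diff a b) x
  freq-tensor (x₁ , x₂ , x₃) =
    sign-product (atMostOne r₁≢r₂ x₁) (atMostOne c₁≢c₂ x₂) (atMostOne a≢b x₃)

  freq-null : InNullSpace v (freq ι)
  freq-null = null-lineSum λ r →
    trans (Σᶠ-cong v (λ t → freq-tensor (line r t)))
          (tensor-lineSum (Σᶠ-diff v r₁ r₂) (Σᶠ-diff v c₁ c₂) (Σᶠ-diff v a b) r)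

inner : ∀ {w} → Point w → Point (suc w)
inner (i , j , k) = (suc i , suc j , suc k)

module _ {w : ℕ} {T U : Vect (suc w)} (T-null : InNullSpace (suc w) T) (U-null : InNullSpace (suc w) U) where

  agree-along-line : ∀ r → (∀ t → T (line r (suc t)) ≡ U (line r (suc t))) →
    T (line r zero) ≡ U (line r zero)
  agree-along-line r = Σᶠ-cancel-head w {λ t → T (line r t)} {λ t → U (line r t)}
    (trans (lineSum-null {T = T} T-null r) (sym (lineSum-null {T = U} U-null r)))

  -- A zero line sum recovers the first point of a line from the others; applied along
  -- the three directions in turn, this fills in coordinates x₁ = 0, then x₂ = 0, then x₃ = 0.
  agree-from-inner : (∀ t → T (inner t) ≡ U (inner t)) → ∀ x → T x ≡ U x
  agree-from-inner T≗U = agree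
    where
    agree₁ : ∀ x₁ j k → T (x₁ , suc j , suc k) ≡ U (x₁ , suc j , suc k)
    agree₁ (suc i) j k = T≗U (i , j , k)
    agree₁ zero    j k = agree-along-line (I23 , suc j , suc k) (λ i → T≗U (i , j , k))
    agree₂ : ∀ x₁ x₂ k → T (x₁ , x₂ , suc k) ≡ U (x₁ , x₂ , suc k)
    agree₂ x₁ (suc j) k = agree₁ x₁ j k
    agree₂ x₁ zero    k = agree-along-line (I13 , x₁ , suc k) (λ j → agree₁ x₁ j k)
    agree : ∀ x → T x ≡ U x
    agree (x₁ , x₂ , suc k) = agree₂ x₁ x₂ k
    agree (x₁ , x₂ , zero)  = agree-along-line (I12 , x₁ , x₂) (agree₂ x₁ x₂)

unitriangular⇒nullSpaceBasis : ∀ {v m} (B : Fin m → Vect v) (P : Fin m → Point v) →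
  (∀ l → InNullSpace v (B l)) →
  (∀ l → B l (P l) ≡ 1ℚ) →
  (∀ l l' → l' ≢ l → B l' (P l) ≡ 0ℚ) →
  (∀ {T U} → InNullSpace v T → InNullSpace v U → (∀ l → T (P l) ≡ U (P l)) → ∀ x → T x ≡ U x) →
  IsNullSpaceBasis v m B
unitriangular⇒nullSpaceBasis {v} {m} B P B-null B-diag B-offdiag P-determines =
  B-null , independent , spanning
  where
  lincomb-at : ∀ c l → lincomb c B (P l) ≡ c l
  lincomb-at c l = begin
    Σᶠ m (λ l' → c l' · B l' (P l)) ≡⟨ Σᶠ-single m l off ⟩
    c l · B l (P l)                 ≡⟨ cong (c l ·_) (B-diag l) ⟩
    c l · 1ℚ                        ≡⟨ *-identityʳ (c l) ⟩
    c l                             ∎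
    where
    off : ∀ l' → l' ≢ l → c l' · B l' (P l) ≡ 0ℚ
    off l' l'≢l = trans (cong (c l' ·_) (B-offdiag l l' l'≢l)) (*-zeroʳ (c l'))
  independent : ∀ c → (∀ x → lincomb c B x ≡ 0ℚ) → ∀ l → c l ≡ 0ℚ
  independent c c·B≡0 l = trans (sym (lincomb-at c l)) (c·B≡0 (P l))
  spanning : ∀ T → InNullSpace v T → ∃[ c ] (∀ x → T x ≡ lincomb c B x)
  spanning T T-null =
    T ∘ P , P-determines T-null (lincomb-null (T ∘ P) B B-null) (λ l → sym (lincomb-at (T ∘ P) l))

δ³ : ∀ {n} → Point n → Point n → ℚ
δ³ (i , j , k) (i' , j' , k') = δ i i' · (δ j j' · δ k k')

δ³-refl : ∀ {n} (t : Point n) → δ³ t t ≡ 1ℚ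
δ³-refl (i , j , k) = cong₂ _·_ (δ-refl i) (cong₂ _·_ (δ-refl j) (δ-refl k))

δ³-≢ : ∀ {n} {s t : Point n} → s ≢ t → δ³ s t ≡ 0ℚ
δ³-≢ {s = i , j , k} {i' , j' , k'} s≢t = vanish (i ≟ i') (j ≟ j') (k ≟ k')
  where
  vanish : Dec (i ≡ i') → Dec (j ≡ j') → Dec (k ≡ k') → δ i i' · (δ j j' · δ k k') ≡ 0ℚ
  vanish (yes i≡i') (yes j≡j') (yes k≡k') = ⊥-elim (s≢t (cong₂ _,_ i≡i' (cong₂ _,_ j≡j' k≡k')))
  vanish (no i≢i') _ _ =
    trans (cong (_· (δ j j' · δ k k')) (δ-≢ i≢i')) (*-zeroˡ (δ j j' · δ k k'))
  vanish (yes _) (no j≢j') _ =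
    trans (cong (λ z → δ i i' · (z · δ k k')) (δ-≢ j≢j'))
          (trans (cong (δ i i' ·_) (*-zeroˡ (δ k k'))) (*-zeroʳ (δ i i')))
  vanish (yes _) (yes _) (no k≢k') =
    trans (cong (λ z → δ i i' · (δ j j' · z)) (δ-≢ k≢k'))
          (trans (cong (δ i i' ·_) (*-zeroʳ (δ j j'))) (*-zeroʳ (δ i i')))

cornerIntercalate : ∀ {w} → Point w → Intercalate (suc w)
cornerIntercalate (i , j , k) = record
  { r₁ = suc i ; r₂ = zero ; c₁ = suc j ; c₂ = zero ; a = suc k ; b = zero
  ; r₁≢r₂ = λ () ; c₁≢c₂ = λ () ; a≢b = λ () }

freq-corner-inner : ∀ {w} (s t : Point w) → freq (cornerIntercalate s) (inner t) ≡ δ³ t s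
freq-corner-inner s@(i' , j' , k') t@(i , j , k) = begin
  freq (cornerIntercalate s) (inner t)
    ≡⟨ freq-tensor (cornerIntercalate s) (inner t) ⟩
  (δ (suc i) (suc i') - 0ℚ) · ((δ (suc j) (suc j') - 0ℚ) · (δ (suc k) (suc k') - 0ℚ))
    ≡⟨ cong₂ _·_ (shrink i i') (cong₂ _·_ (shrink j j') (shrink k k')) ⟩
  δ³ t s ∎
  where
  shrink : ∀ x y → δ (suc x) (suc y) - 0ℚ ≡ δ x y
  shrink x y = trans (+-identityʳ (δ (suc x) (suc y))) (δ-suc x y)

points↔ : ∀ w → Fin (w * (w * w)) ↔ Point w
points↔ w = ↔-trans *↔× (↔-refl ×-↔ *↔×)

theorem2 : (v : ℕ) → 2 ≤ v →
    ∃[ m ] Σ (Fin m → Intercalate v) (λ ι → IsNullSpaceBasis v m (λ i → freq (ι i)))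
-- The bound only excludes v = 0: for v = 1 the family below is empty and the null space is zero.
theorem2 (suc w) _ =
  w * (w * w) , cornerIntercalate ∘ to ,
  unitriangular⇒nullSpaceBasis _ (inner ∘ to)
    (λ l → freq-null (cornerIntercalate (to l)))
    (λ l → trans (freq-corner-inner (to l) (to l)) (δ³-refl (to l)))
    (λ l l' l'≢l → trans (freq-corner-inner (to l') (to l))
                         (δ³-≢ (λ to-l≡to-l' → l'≢l (sym (to-injective to-l≡to-l')))))
    (λ {T} {U} T-null U-null agree → agree-from-inner T-null U-null λ t →
       subst (λ s → T (inner s) ≡ U (inner s)) (strictlyInverseˡ t) (agree (from t)))
  where
  open Inverse (points↔ w)
  to-injective : ∀ {l l'} → to l ≡ to l' → l ≡ l'
  to-injective = Injection.injective (↔⇒↣ (points↔ w))
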